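{- Let $G$ and $H$ be connected graphs, each with at least two vertices and at least one of them with at least three vertices. Let $k_1=\chi(G)$, $k_2=\chi(H)$, let $f_G:V(G)\to[k_1]$ and $f_H:V(H)\to[k_2]$ be proper colorings, and define $g:V(G\times H)\to[k_1]\times[k_2]$ by $g((u,v))=(f_G(u),f_H(v))$. If $e=(u_1,v_1)(u_2,v_2)$ is an edge of $G\times H$ that is bad with respect to $g$, then $$g(N[(u_1,v_1)])=g(N[(u_2,v_2)])=\{g((u_1,v_1)),g((u_2,v_2))\}=\{(f_G(u_1),f_H(v_1)),(f_G(u_2),f_H(v_2))\}.$$
   Context: $[k]=\{1,\dots,k\}$; $\chi(G)$ is the chromatic number. A proper coloring assigns distinct colors to adjacent vertices. $N[x]$ denotes the closed neighborhood of a vertex $x$, and $g(S)=\{g(x):x\in S\}$. The tensor product $G\times H$ has vertex set $V(G)\times V(H)$, where $(u_1,v_1)$ and $(u_2,v_2)$ are adjacent iff $u_1u_2\in E(G)$ and $v_1v_2\in E(H)$. An edge $uv$ is bad with respect to a coloring $g$ if $N[u]\neq N[v]$ but $g(N[u])=g(N[v])$. -}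

module Defs where

open import Data.Nat using (ℕ; _<_)
open import Data.Fin using (Fin)
open import Data.Product using (Σ; _×_; _,_)
open import Data.Sum using (_⊎_)
open import Relation.Nullary using (¬_)
open import Relation.Binary.PropositionalEquality using (_≡_; _≢_)
open import Function.Bundles using (_⇔_)

record Graph : Set₁ where
  field
    n     : ℕ
    Adj   : Fin n → Fin n → Set
    sym   : ∀ {x y} → Adj x y → Adj y x
    irrefl : ∀ {x} → ¬ Adj x x
open Graph public

data Walk (G : Graph) : Fin (n G) → Fin (n G) → Set where
  here : ∀ {x} → Walk G x x
  step : ∀ {x y z} → Adj G x y → Walk G y z → Walk G x z

Connected : Graph → Set
Connected G = ∀ x y → Walk G x y

Proper : (G : Graph) {k : ℕ} → (Fin (n G) → Fin k) → Set
Proper G f = ∀ {x y} → Adj G x y → f x ≢ f y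

Colorable : Graph → ℕ → Set
Colorable G k = Σ (Fin (n G) → Fin k) (Proper G)

IsChromaticNumber : Graph → ℕ → Set
IsChromaticNumber G k = Colorable G k × (∀ m → m < k → ¬ Colorable G m)

TAdj : (G H : Graph) → Fin (n G) × Fin (n H) → Fin (n G) × Fin (n H) → Set
TAdj G H (u₁ , v₁) (u₂ , v₂) = Adj G u₁ u₂ × Adj H v₁ v₂

module _ {V : Set} (A : V → V → Set) where
  N[_] : V → V → Set
  N[ x ] y = (y ≡ x) ⊎ A x y

  Img : {C : Set} → (V → C) → V → C → Set
  Img g x c = Σ V (λ y → N[ x ] y × g y ≡ c)

  Bad : {C : Set} → (V → C) → V → V → Set
  Bad g u v = A u v
            × ¬ (∀ y → N[ u ] y ⇔ N[ v ] y)
            × (∀ c → Img g u c ⇔ Img g v c)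

prodCol : (G H : Graph) {k₁ k₂ : ℕ} → (Fin (n G) → Fin k₁) → (Fin (n H) → Fin k₂)
        → Fin (n G) × Fin (n H) → Fin k₁ × Fin k₂
prodCol G H fG fH (u , v) = fG u , fH v

-- If (u₁,v₁)(u₂,v₂) is an edge of G × H whose ends see the same colours, take a
-- neighbour (a,b) of (u₁,v₁). Then (a,v₂) is also a neighbour, and its colour
-- (f_G a, f_H v₂) must occur in N[(u₂,v₂)]; every proper neighbour of (u₂,v₂) has
-- H-colour different from f_H v₂, so it is (u₂,v₂) itself and f_G a = f_G u₂.
-- Symmetrically f_H b = f_H v₂, so every colour near (u₁,v₁) is g(u₁,v₁) or g(u₂,v₂).
module Submission where

open import Defs hiding (sym)
open import Data.Nat using (ℕ; _≤_)
open import Data.Fin using (Fin)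
open import Data.Product using (_×_; _,_)
open import Data.Product.Properties using (,-injectiveˡ; ,-injectiveʳ)
open import Data.Sum using (_⊎_; inj₁; inj₂)
open import Data.Empty using (⊥-elim)
open import Relation.Binary.PropositionalEquality
  using (_≡_; refl; sym; trans; cong₂)
open import Function.Bundles using (_⇔_; mk⇔; Equivalence)

module _ (G H : Graph) {k₁ k₂ : ℕ}
         {fG : Fin (n G) → Fin k₁} (properG : Proper G fG)
         {fH : Fin (n H) → Fin k₂} (properH : Proper H fH) where

  private
    V = Fin (n G) × Fin (n H)
    g = prodCol G H fG fH
    Image = Img (TAdj G H) g

  _⊆ᶜ_ : V → V → Set
  x ⊆ᶜ y = ∀ {c} → Image x c → Image y c

  ⊆ᶜ⇒colourˡ-of-neighbour : ∀ {u₁ u₂ v₁ v₂ a} → TAdj G H (u₁ , v₁) (u₂ , v₂)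
                          → (u₁ , v₁) ⊆ᶜ (u₂ , v₂) → Adj G u₁ a → fG a ≡ fG u₂
  ⊆ᶜ⇒colourˡ-of-neighbour {a = a} (_ , v₁v₂) sub u₁a
    with sub ((a , _) , inj₂ (u₁a , v₁v₂) , refl)
  ... | _ , inj₁ refl , e = ,-injectiveˡ (sym e)
  ... | _ , inj₂ (_ , v₂b) , e = ⊥-elim (properH v₂b (sym (,-injectiveʳ e)))

  ⊆ᶜ⇒colourʳ-of-neighbour : ∀ {u₁ u₂ v₁ v₂ b} → TAdj G H (u₁ , v₁) (u₂ , v₂)
                          → (u₁ , v₁) ⊆ᶜ (u₂ , v₂) → Adj H v₁ b → fH b ≡ fH v₂
  ⊆ᶜ⇒colourʳ-of-neighbour {b = b} (u₁u₂ , _) sub v₁b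
    with sub ((_ , b) , inj₂ (u₁u₂ , v₁b) , refl)
  ... | _ , inj₁ refl , e = ,-injectiveʳ (sym e)
  ... | _ , inj₂ (u₂a , _) , e = ⊥-elim (properG u₂a (sym (,-injectiveˡ e)))

  ⊆ᶜ⇒Image⊆ends : ∀ {x y c} → TAdj G H x y → x ⊆ᶜ y
                → Image x c → c ≡ g x ⊎ c ≡ g y
  ⊆ᶜ⇒Image⊆ends _ _ (_ , inj₁ refl , e) = inj₁ (sym e)
  ⊆ᶜ⇒Image⊆ends xy sub (_ , inj₂ (u₁a , v₁b) , e) =
    inj₂ (trans (sym e) (cong₂ _,_ (⊆ᶜ⇒colourˡ-of-neighbour xy sub u₁a)
                                   (⊆ᶜ⇒colourʳ-of-neighbour xy sub v₁b)))

  ends⊆Image : ∀ {x y c} → TAdj G H x y → c ≡ g x ⊎ c ≡ g y → Image x c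
  ends⊆Image {x} _  (inj₁ refl) = x , inj₁ refl , refl
  ends⊆Image {y = y} xy (inj₂ refl) = y , inj₂ xy , refl

lemma15 : (G H : Graph) → Connected G → Connected H
            → 2 ≤ n G → 2 ≤ n H → (3 ≤ n G ⊎ 3 ≤ n H)
            → (k₁ k₂ : ℕ) → IsChromaticNumber G k₁ → IsChromaticNumber H k₂
            → (fG : Fin (n G) → Fin k₁) → Proper G fG
            → (fH : Fin (n H) → Fin k₂) → Proper H fH
            → (u₁ u₂ : Fin (n G)) (v₁ v₂ : Fin (n H))
            → Bad (TAdj G H) (prodCol G H fG fH) (u₁ , v₁) (u₂ , v₂)
            → ((c : Fin k₁ × Fin k₂)
                → Img (TAdj G H) (prodCol G H fG fH) (u₁ , v₁) c
                  ⇔ Img (TAdj G H) (prodCol G H fG fH) (u₂ , v₂) c)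
              × ((c : Fin k₁ × Fin k₂)
                → Img (TAdj G H) (prodCol G H fG fH) (u₁ , v₁) c
                  ⇔ ((c ≡ (fG u₁ , fH v₁)) ⊎ (c ≡ (fG u₂ , fH v₂))))
              × ((c : Fin k₁ × Fin k₂)
                → Img (TAdj G H) (prodCol G H fG fH) (u₂ , v₂) c
                  ⇔ ((c ≡ (fG u₁ , fH v₁)) ⊎ (c ≡ (fG u₂ , fH v₂))))
lemma15 G H _ _ _ _ _ _ _ _ _ fG properG fH properH u₁ u₂ v₁ v₂ (xy , _ , sameImage) =
  sameImage
  , (λ c → mk⇔ x-ends ends-x)
  , (λ c → mk⇔ (λ i → x-ends (y⊆x i)) (λ e → x⊆y (ends-x e)))
  where
  x⊆y = λ {c} → Equivalence.to (sameImage c)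
  y⊆x = λ {c} → Equivalence.from (sameImage c)
  x-ends = λ {c} → ⊆ᶜ⇒Image⊆ends G H properG properH {c = c} xy x⊆y
  ends-x = λ {c} → ends⊆Image G H properG properH {c = c} xy
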